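{- Let $k\ge3$, $m\ge1$ with $mk+2$ even, $W=I_2(k)$, let $\Gamma^{(m)}$ be its $m$-cluster complex with Fomin–Reading rotation $\mathcal{R}_m$, and let $\rho=\mathcal{R}_m^{(mk+2)/2}$ (the half-turn). If $k$ is even, every facet of $\Gamma^{(m)}$ is fixed by $\rho$. If $k$ is odd, exactly $\frac{mk+2}{2}$ facets of $\Gamma^{(m)}$ are fixed by $\rho$.
   Context: $W=I_2(k)$ is the dihedral group of order $2k$ with root system $\Phi$, simple roots $\alpha_1,\alpha_2$, simple reflections $s_1,s_2$, $c_+=s_1$, $c_-=s_2$. Almost positive roots: $\Phi_{\ge-1}=\Phi_+\cup\{ -\alpha_1,-\alpha_2\}$. Fomin–Zelevinsky rotation: $\tau_+(\alpha)=\alpha$ if $\alpha=-\alpha_2$, else $c_+(\alpha)$; $\tau_-(\alpha)=\alpha$ if $\alpha=-\alpha_1$, else $c_-(\alpha)$; $\mathcal{R}=\tau_-\tau_+$. $m$-colored almost positive roots: $\Phi^{(m)}_{\ge-1}=\{\alpha^i:\alpha\in\Phi_+,1\le i\le m\}\cup\{(-\alpha_1)^1,(-\alpha_2)^1\}$. Fomin–Reading rotation: $\mathcal{R}_m(\alpha^i)=\alpha^{i+1}$ if $\alpha\in\Phi_+$ and $i<m$, and $(\mathcal{R}(\alpha))^1$ otherwise; its order divides $mk+2$. Compatibility: the unique symmetric relation with $(-\alpha_j)^1\|\beta^i$ iff $\alpha_j$ has coefficient $0$ in $\beta$, invariant under $\mathcal{R}_m$. $\Gamma^{(m)}$ is the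 simplicial complex of pairwise compatible sets; its facets are its maximal faces (two-element sets), which are exactly the faces of trivial parabolic type. -}

module Defs where

open import Data.Nat using (ℕ; zero; suc; _+_; _*_; _∸_; _<_; _≤ᵇ_; _<?_; _≟_; NonZero)
open import Data.Fin using (Fin; zero; suc; toℕ; fromℕ<)
open import Data.Bool using (Bool; true; false; if_then_else_)
open import Data.Product using (_×_; ∃)
open import Data.Empty using (⊥)
open import Data.Unit using (⊤)
open import Data.List using (List; length)
open import Data.List.Relation.Unary.All using (All)
open import Data.List.Relation.Unary.Any using (Any)
open import Data.List.Relation.Unary.AllPairs using (AllPairs)
open import Relation.Nullary using (¬_; yes; no)
open import Relation.Binary.PropositionalEquality using (_≡_; _≢_)
open import Function.Bundles using (_⇔_)

-- The 2k roots are unit vectors at angles a·π/k, a ∈ {0,…,2k-1}.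
-- α₁ has angle 0, α₂ has angle (k-1)π/k; the positive roots are the
-- angles 0,…,k-1 (posα j has angle j·π/k, so posα 0 = α₁,
-- posα (k-1) = α₂).  The negative root -β has angle (angle β) + k.

-- almost positive roots Φ_{≥-1}:  negα 0 = -α₁,  negα 1 = -α₂
data AP (k : ℕ) : Set where
  negα : Fin 2 → AP k
  posα : Fin k → AP k

angle : (k : ℕ) → AP k → ℕ
angle k (posα j)           = toℕ j
angle k (negα zero)        = k
angle k (negα (suc zero))  = 2 * k ∸ 1

-- back from an angle (only ever applied to angles of almost positive roots)
fromAngle : (k : ℕ) → ℕ → AP k
fromAngle k a with a <? k
... | yes p = posα (fromℕ< p)
... | no _ with a ≟ k
...   | yes _ = negα zero
...   | no _  = negα (suc zero)

-- s₁ : reflection orthogonal to α₁ :  θ ↦ π - θ,  i.e. a ↦ k - a (mod 2k)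
refl₁ : ℕ → ℕ → ℕ
refl₁ k a = if a ≤ᵇ k then k ∸ a else (3 * k) ∸ a

-- s₂ : reflection orthogonal to α₂ :  θ ↦ 2(k-1)π/k + π - θ,
--      i.e. a ↦ k - 2 - a (mod 2k)
refl₂ : ℕ → ℕ → ℕ
refl₂ k a = if a ≤ᵇ (k ∸ 2) then (k ∸ 2) ∸ a else (3 * k ∸ 2) ∸ a

-- Fomin–Zelevinsky τ₊ (c₊ = s₁) and τ₋ (c₋ = s₂)
τ₊ : (k : ℕ) → AP k → AP k
τ₊ k (negα (suc zero)) = negα (suc zero)
τ₊ k α = fromAngle k (refl₁ k (angle k α))

τ₋ : (k : ℕ) → AP k → AP k
τ₋ k (negα zero) = negα zero
τ₋ k α = fromAngle k (refl₂ k (angle k α))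

Rot : (k : ℕ) → AP k → AP k
Rot k α = τ₋ k (τ₊ k α)

-- m-colored almost positive roots Φ^{(m)}_{≥-1}
-- negc j = (-α_{j+1})^1,  posc j i = (posα j)^{i+1}

data Col (k m : ℕ) : Set where
  negc : Fin 2 → Col k m
  posc : Fin k → Fin m → Col k m

firstColour : (m : ℕ) → .{{NonZero m}} → Fin m
firstColour (suc m) = zero

colour1 : (k m : ℕ) → .{{NonZero m}} → AP k → Col k m
colour1 k m (negα j) = negc j
colour1 k m (posα j) = posc j (firstColour m)

Rm : (k m : ℕ) → .{{NonZero m}} → Col k m → Col k m
Rm k m (negc j) = colour1 k m (Rot k (negα j))
Rm k m (posc j i) with suc (toℕ i) <? m
... | yes p = posc j (fromℕ< p)
... | no _  = colour1 k m (Rot k (posα j))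

iter : {A : Set} → ℕ → (A → A) → A → A
iter zero    f x = x
iter (suc n) f x = f (iter n f x)

-- "α_j has coefficient 0 in β" for β^i a colored almost positive root
-- (j = zero is α₁, j = suc zero is α₂).  Among almost positive roots,
-- the α₁-coefficient vanishes exactly for ±α₂, the α₂-coefficient
-- exactly for ±α₁ (all other positive roots have both coefficients > 0).
CoeffZero : (k m : ℕ) → Fin 2 → Col k m → Set
CoeffZero k m zero (negc zero)              = ⊥
CoeffZero k m zero (negc (suc zero))        = ⊤
CoeffZero k m zero (posc j i)               = toℕ j ≡ k ∸ 1
CoeffZero k m (suc zero) (negc zero)        = ⊤
CoeffZero k m (suc zero) (negc (suc zero))  = ⊥
CoeffZero k m (suc zero) (posc j i)         = toℕ j ≡ 0

record IsCompatibility (k m : ℕ) .{{_ : NonZero m}}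
         (_∥_ : Col k m → Col k m → Set) : Set₁ where
  field
    sym∥       : ∀ a b → a ∥ b → b ∥ a
    invariant  : ∀ a b → (a ∥ b) ⇔ (Rm k m a ∥ Rm k m b)
    negSimple  : ∀ j b → (negc j ∥ b) ⇔ CoeffZero k m j b

-- The complex Γ^{(m)}: faces are (finite) sets of pairwise compatible
-- colored roots; sets are represented by characteristic functions.

CSet : (k m : ℕ) → Set
CSet k m = Col k m → Bool

_⊆_ : {k m : ℕ} → CSet k m → CSet k m → Set
F ⊆ G = ∀ a → F a ≡ true → G a ≡ true

_≐_ : {k m : ℕ} → CSet k m → CSet k m → Set
F ≐ G = ∀ a → F a ≡ G a

IsFace : (k m : ℕ) → (Col k m → Col k m → Set) → CSet k m → Set
IsFace k m _∥_ F = ∀ a b → F a ≡ true → F b ≡ true → a ≢ b → a ∥ b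

IsFacet : (k m : ℕ) → (Col k m → Col k m → Set) → CSet k m → Set
IsFacet k m _∥_ F =
  IsFace k m _∥_ F × (∀ G → IsFace k m _∥_ G → F ⊆ G → G ⊆ F)

FixedBy : {k m : ℕ} → (Col k m → Col k m) → CSet k m → Set
FixedBy ρ F = ∀ y → (F y ≡ true) ⇔ (∃ λ x → F x ≡ true × ρ x ≡ y)

HasExactly : {k m : ℕ} → ℕ → (CSet k m → Set) → Set
HasExactly {k} {m} n P =
  ∃ λ (L : List (CSet k m)) →
    length L ≡ n × All P L × AllPairs (λ F G → ¬ (F ≐ G)) L ×
    (∀ F → P F → Any (λ G → F ≐ G) L)

{-# OPTIONS --safe #-}
module Submission where

-- In the angle model (β_j = posα j at angle jπ/k, so β₀ = α₁ and β_{k-1} = α₂), R_m raises the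
-- colour of β_j^i and sends the last colour of β_j to β_{j-2}^1; the last colours of β₁ and β₀ go to
-- -α₂ and -α₁, which go on to β_{k-1}^1 and β_{k-2}^1.  For even k = 2r the colored roots thus split
-- into the R_m-orbits of -α₁ and -α₂, each of length rm + 1 = (mk+2)/2, and ρ is the identity.  For
-- odd k the orbit of -α₂ is everything and has length N = mk + 2, so ρ is a fixed-point-free
-- involution.  Compatibility is R_m-invariant, so it can be tested after rotating one argument to -α₂,
-- whose neighbours are the α₂-free roots; these fill a window of m + 1 consecutive points of the orbit
-- that contains ρ(-α₂) but is disjoint from its own image under ρ.  Hence a ∥ ρ a and no root is
-- compatible with both, so the ρ-fixed facets are exactly the N/2 orbits {a, ρ a}.

open import Defs
open import Data.Nat
open import Data.Nat.Properties
open import Data.Nat.DivMod using (_%_; _/_; m%n<n; m≡m%n+[m/n]*n)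
open import Data.Nat.Divisibility using (_∣_; divides)
open import Data.Nat.Tactic.RingSolver using (solve-∀)
open import Data.Fin as Fin using (Fin; zero; suc; toℕ; fromℕ<)
open import Data.Fin.Properties using (toℕ-fromℕ<; fromℕ<-toℕ; toℕ<n; toℕ-injective; any?)
open import Data.Bool as Bool using (true; false; _∨_)
open import Data.Bool.Properties using (T-≡; ¬-not)
open import Data.Empty using (⊥; ⊥-elim)
open import Data.Product using (_×_; _,_; ∃; ∃₂; proj₂)
open import Data.Sum using (_⊎_; inj₁; inj₂; [_,_])
open import Data.List using (tabulate)
open import Data.List.Properties using (length-tabulate)
open import Data.List.Relation.Unary.Any using (Any)
import Data.List.Relation.Unary.All.Properties as All
import Data.List.Relation.Unary.Any.Properties as Any
import Data.List.Relation.Unary.AllPairs.Properties as AllPairs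
open import Function using (_∘_)
open import Function.Bundles using (_⇔_; mk⇔; Equivalence)
import Function.Properties.Equivalence as ⇔
open import Relation.Nullary using (¬_; Dec; yes; no; does; contradiction)
open import Relation.Nullary.Decidable using (map′; _⊎-dec_)
open import Relation.Binary.PropositionalEquality hiding ([_])

even-or-odd : ∀ n → (∃ λ s → n ≡ s + s) ⊎ (∃ λ s → n ≡ suc (s + s))
even-or-odd zero = inj₁ (0 , refl)
even-or-odd (suc n) with even-or-odd n
... | inj₁ (s , refl) = inj₂ (s , refl)
... | inj₂ (s , refl) = inj₁ (suc s , cong suc (sym (+-suc s s)))

2*n≡n+n : ∀ n → 2 * n ≡ n + n
2*n≡n+n n = cong (n +_) (+-identityʳ n)

iter-+ : ∀ {A : Set} (f : A → A) a b x → iter (a + b) f x ≡ iter a f (iter b f x)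
iter-+ f zero    b x = refl
iter-+ f (suc a) b x = cong f (iter-+ f a b x)

iter-comm : ∀ {A : Set} (f : A → A) a b x → iter a f (iter b f x) ≡ iter b f (iter a f x)
iter-comm f a b x = begin
  iter a f (iter b f x)  ≡⟨ iter-+ f a b x ⟨
  iter (a + b) f x       ≡⟨ cong (λ n → iter n f x) (+-comm a b) ⟩
  iter (b + a) f x       ≡⟨ iter-+ f b a x ⟩
  iter b f (iter a f x)  ∎
  where open ≡-Reasoning

-- Sets of colored roots

module _ {k m : ℕ} where

  infix 4 _≟ᶜ_
  _≟ᶜ_ : (a b : Col k m) → Dec (a ≡ b)
  negc j ≟ᶜ negc j′ with j Fin.≟ j′
  ... | yes refl = yes refl
  ... | no j≢j′  = no λ { refl → j≢j′ refl }
  negc _ ≟ᶜ posc _ _ = no λ ()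
  posc _ _ ≟ᶜ negc _ = no λ ()
  posc j i ≟ᶜ posc j′ i′ with j Fin.≟ j′ | i Fin.≟ i′
  ... | yes refl | yes refl = yes refl
  ... | no j≢j′  | _        = no λ { refl → j≢j′ refl }
  ... | yes _    | no i≢i′  = no λ { refl → i≢i′ refl }

  ⁅_⁆ : Col k m → CSet k m
  ⁅ a ⁆ c = does (c ≟ᶜ a)

  pair : Col k m → Col k m → CSet k m
  pair a b c = does (c ≟ᶜ a) ∨ does (c ≟ᶜ b)

  ∈⁅⁆⇔ : ∀ {a c} → ⁅ a ⁆ c ≡ true ⇔ c ≡ a
  ∈⁅⁆⇔ {a} {c} with c ≟ᶜ a
  ... | yes c≡a = mk⇔ (λ _ → c≡a) (λ _ → refl)
  ... | no  c≢a = mk⇔ (λ ()) (λ c≡a → contradiction c≡a c≢a)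

  ∈pair⇔ : ∀ {a b c} → pair a b c ≡ true ⇔ (c ≡ a ⊎ c ≡ b)
  ∈pair⇔ {a} {b} {c} with c ≟ᶜ a | c ≟ᶜ b
  ... | yes c≡a | _       = mk⇔ (λ _ → inj₁ c≡a) (λ _ → refl)
  ... | no _    | yes c≡b = mk⇔ (λ _ → inj₂ c≡b) (λ _ → refl)
  ... | no c≢a  | no c≢b  = mk⇔ (λ ()) (⊥-elim ∘ [ c≢a , c≢b ])

  ⊆-antisym : ∀ {F G : CSet k m} → F ⊆ G → G ⊆ F → F ≐ G
  ⊆-antisym {F} {G} F⊆G G⊆F c with F c in Fc | G c in Gc
  ... | true  | true  = refl
  ... | false | false = refl
  ... | true  | false = trans (sym (F⊆G c Fc)) Gc
  ... | false | true  = trans (sym Fc) (G⊆F c Gc)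

  nonempty? : (F : CSet k m) → Dec (∃ λ a → F a ≡ true)
  nonempty? F = map′ from-parts to-parts
    (any? (λ j → F (negc j) Bool.≟ true) ⊎-dec any? (λ j → any? (λ i → F (posc j i) Bool.≟ true)))
    where
    Parts : Set
    Parts = (∃ λ j → F (negc j) ≡ true) ⊎ (∃ λ j → ∃ λ i → F (posc j i) ≡ true)
    from-parts : Parts → ∃ λ a → F a ≡ true
    from-parts (inj₁ (j , Fa))       = negc j , Fa
    from-parts (inj₂ (j , i , Fa))   = posc j i , Fa
    to-parts : (∃ λ a → F a ≡ true) → Parts
    to-parts (negc j , Fa)   = inj₁ (j , Fa)
    to-parts (posc j i , Fa) = inj₂ (j , i , Fa)

  module _ {_∥_ : Col k m → Col k m → Set} where

    singleton-isFace : ∀ a → IsFace k m _∥_ ⁅ a ⁆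
    singleton-isFace a x y x∈ y∈ x≢y =
      contradiction (trans (Equivalence.to ∈⁅⁆⇔ x∈) (sym (Equivalence.to ∈⁅⁆⇔ y∈))) x≢y

    facet-nonempty : ∀ {F} → IsFacet k m _∥_ F → ∃ λ a → F a ≡ true
    facet-nonempty {F} (_ , maximal) with nonempty? F
    ... | yes F-inhabited = F-inhabited
    ... | no  F-empty     = contradiction (a , ⁅a⁆⊆F a (Equivalence.from (∈⁅⁆⇔ {a}) refl)) F-empty
      where
      a : Col k m
      a = negc zero
      ⁅a⁆⊆F : ⁅ a ⁆ ⊆ F
      ⁅a⁆⊆F = maximal ⁅ a ⁆ (singleton-isFace a) (λ c Fc → contradiction (c , Fc) F-empty)

  fixedBy-id : ∀ {ρ : Col k m → Col k m} → (∀ a → ρ a ≡ a) → ∀ F → FixedBy ρ F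
  fixedBy-id ρ≡id F y = mk⇔ (λ Fy → y , Fy , ρ≡id y)
    λ { (x , Fx , ρx≡y) → subst (λ z → F z ≡ true) (trans (sym (ρ≡id x)) ρx≡y) Fx }

-- Facets fixed by an involution

module Orbits {k m : ℕ} (ρ : Col k m → Col k m) (ρ-involutive : ∀ a → ρ (ρ a) ≡ a) where

  orbit : Col k m → CSet k m
  orbit a = pair a (ρ a)

  ∈orbit⇔ : ∀ a c → orbit a c ≡ true ⇔ (c ≡ a ⊎ c ≡ ρ a)
  ∈orbit⇔ a c = ∈pair⇔

  ∈orbit⁻ : ∀ a c → orbit a c ≡ true → c ≡ a ⊎ c ≡ ρ a
  ∈orbit⁻ a c = Equivalence.to (∈orbit⇔ a c)

  orbit-∋ : ∀ a → orbit a a ≡ true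
  orbit-∋ a = Equivalence.from (∈orbit⇔ a a) (inj₁ refl)

  orbit-∋ρ : ∀ a → orbit a (ρ a) ≡ true
  orbit-∋ρ a = Equivalence.from (∈orbit⇔ a (ρ a)) (inj₂ refl)

  orbit-ρ : ∀ a → orbit (ρ a) ≐ orbit a
  orbit-ρ a = ⊆-antisym ρa-side a-side
    where
    ρa-side : orbit (ρ a) ⊆ orbit a
    ρa-side c c∈ with ∈orbit⁻ (ρ a) c c∈
    ... | inj₁ refl = orbit-∋ρ a
    ... | inj₂ refl = subst (λ z → orbit a z ≡ true) (sym (ρ-involutive a)) (orbit-∋ a)
    a-side : orbit a ⊆ orbit (ρ a)
    a-side c c∈ with ∈orbit⁻ a c c∈
    ... | inj₁ refl = subst (λ z → orbit (ρ c) z ≡ true) (ρ-involutive c) (orbit-∋ρ (ρ c))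
    ... | inj₂ refl = orbit-∋ (ρ a)

  orbit-fixed : ∀ a → FixedBy ρ (orbit a)
  orbit-fixed a y = mk⇔ to from
    where
    to : orbit a y ≡ true → ∃ λ x → orbit a x ≡ true × ρ x ≡ y
    to y∈ with ∈orbit⁻ a y y∈
    ... | inj₁ refl = ρ y , orbit-∋ρ y , ρ-involutive y
    ... | inj₂ refl = a , orbit-∋ a , refl
    from : (∃ λ x → orbit a x ≡ true × ρ x ≡ y) → orbit a y ≡ true
    from (x , x∈ , refl) with ∈orbit⁻ a x x∈
    ... | inj₁ refl = orbit-∋ρ x
    ... | inj₂ refl = Equivalence.from (∈orbit⇔ a (ρ (ρ a))) (inj₁ (ρ-involutive a))

  module _ {_∥_ : Col k m → Col k m → Set}
           (sym∥ : ∀ a b → a ∥ b → b ∥ a)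
           (∥-ρ : ∀ a → a ∥ ρ a)
           (no-common-neighbour : ∀ c a → c ∥ a → c ∥ ρ a → ⊥) where

    orbit-isFacet : ∀ a → IsFacet k m _∥_ (orbit a)
    orbit-isFacet a = isFace , maximal
      where
      isFace : IsFace k m _∥_ (orbit a)
      isFace x y x∈ y∈ x≢y with ∈orbit⁻ a x x∈ | ∈orbit⁻ a y y∈
      ... | inj₁ refl | inj₁ refl = contradiction refl x≢y
      ... | inj₁ refl | inj₂ refl = ∥-ρ x
      ... | inj₂ refl | inj₁ refl = sym∥ y x (∥-ρ y)
      ... | inj₂ refl | inj₂ refl = contradiction refl x≢y
      maximal : ∀ G → IsFace k m _∥_ G → orbit a ⊆ G → G ⊆ orbit a
      maximal G G-face a∈G c c∈G with c ≟ᶜ a | c ≟ᶜ ρ a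
      ... | yes _ | _     = refl
      ... | no _  | yes _ = refl
      ... | no c≢a | no c≢ρa = ⊥-elim (no-common-neighbour c a
            (G-face c a c∈G (a∈G a (orbit-∋ a)) c≢a) (G-face c (ρ a) c∈G (a∈G (ρ a) (orbit-∋ρ a)) c≢ρa))

    fixedFacet-orbit : ∀ F → IsFacet k m _∥_ F → FixedBy ρ F → ∃ λ a → F ≐ orbit a
    fixedFacet-orbit F F-facet@(F-face , _) F-fixed with facet-nonempty F-facet
    ... | a , a∈F = a , ⊆-antisym (proj₂ (orbit-isFacet a) F F-face orbit⊆F) orbit⊆F
      where
      orbit⊆F : orbit a ⊆ F
      orbit⊆F c c∈ with ∈orbit⁻ a c c∈
      ... | inj₁ refl = a∈F
      ... | inj₂ refl = Equivalence.from (F-fixed (ρ a)) (a , a∈F , refl)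

  module _ (h : ℕ) (U : ℕ → Col k m)
           (U-injective : ∀ p q → p < h + h → q < h + h → U p ≡ U q → p ≡ q)
           (U-surjective : ∀ a → ∃ λ p → p < h + h × U p ≡ a)
           (ρ-U : ∀ p → ρ (U p) ≡ U (h + p)) where

    <h⇒<2h : ∀ {n} → n < h → n < h + h
    <h⇒<2h n<h = <-≤-trans n<h (m≤m+n h h)

    orbits-distinct : ∀ p q → p < h → q < h → p ≢ q → ¬ (orbit (U p) ≐ orbit (U q))
    orbits-distinct p q p<h q<h p≢q same with ∈orbit⁻ (U q) (U p) (trans (sym (same (U p))) (orbit-∋ (U p)))
    ... | inj₁ Up≡Uq  = p≢q (U-injective p q (<h⇒<2h p<h) (<h⇒<2h q<h) Up≡Uq)
    ... | inj₂ Up≡ρUq = <⇒≱ p<h (subst (h ≤_) (sym p≡h+q) (m≤m+n h q))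
      where
      p≡h+q : p ≡ h + q
      p≡h+q = U-injective p (h + q) (<h⇒<2h p<h) (+-monoʳ-< h q<h) (trans Up≡ρUq (ρ-U q))

    orbit-representative : ∀ a → ∃ λ p → p < h × orbit a ≐ orbit (U p)
    orbit-representative a with U-surjective a
    ... | p , p<2h , refl with p <? h
    ...   | yes p<h = p , p<h , λ _ → refl
    ...   | no  p≮h = p ∸ h , q<h , λ c → begin
            orbit (U p) c                ≡⟨ cong (λ n → orbit (U n) c) (sym (m+[n∸m]≡n h≤p)) ⟩
            orbit (U (h + (p ∸ h))) c    ≡⟨ cong (λ b → orbit b c) (sym (ρ-U (p ∸ h))) ⟩
            orbit (ρ (U (p ∸ h))) c      ≡⟨ orbit-ρ (U (p ∸ h)) c ⟩
            orbit (U (p ∸ h)) c          ∎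
      where
      open ≡-Reasoning
      h≤p : h ≤ p
      h≤p = ≮⇒≥ p≮h
      q<h : p ∸ h < h
      q<h = +-cancelˡ-< h (p ∸ h) h (subst (_< h + h) (sym (m+[n∸m]≡n h≤p)) p<2h)

    hasExactly-orbits : (P : CSet k m → Set) → (∀ a → P (orbit a)) →
                        (∀ F → P F → ∃ λ a → F ≐ orbit a) → HasExactly h P
    hasExactly-orbits P P-orbit P⇒orbit =
        tabulate orbitAt
      , length-tabulate orbitAt
      , All.tabulate⁺ (P-orbit ∘ U ∘ toℕ)
      , AllPairs.tabulate⁺ (λ {i} {j} i≢j → orbits-distinct (toℕ i) (toℕ j) (toℕ<n i) (toℕ<n j) (i≢j ∘ toℕ-injective))
      , cover
      where
      orbitAt : Fin h → CSet k m
      orbitAt = orbit ∘ U ∘ toℕ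
      cover : ∀ F → P F → Any (F ≐_) (tabulate orbitAt)
      cover F PF with P⇒orbit F PF
      ... | a , F≐orbit with orbit-representative a
      ...   | p , p<h , a~Up = Any.tabulate⁺ (fromℕ< p<h) λ c →
              trans (F≐orbit c) (trans (a~Up c) (cong (λ n → orbit (U n) c) (sym (toℕ-fromℕ< p<h))))

module _ {k m : ℕ} .{{_ : NonZero m}} {_∥_ : Col k m → Col k m → Set} (C : IsCompatibility k m _∥_) where
  open IsCompatibility C

  iter-∥⇔ : ∀ n a b → (a ∥ b) ⇔ (iter n (Rm k m) a ∥ iter n (Rm k m) b)
  iter-∥⇔ zero    a b = ⇔.refl
  iter-∥⇔ (suc n) a b = ⇔.trans (iter-∥⇔ n a b) (invariant _ _)

-- The rotation in coordinates

≤ᵇ-≡true : ∀ {a b} → a ≤ b → (a ≤ᵇ b) ≡ true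
≤ᵇ-≡true = Equivalence.to T-≡ ∘ ≤⇒≤ᵇ

≤ᵇ-≡false : ∀ {a b} → ¬ a ≤ b → (a ≤ᵇ b) ≡ false
≤ᵇ-≡false a≰b = ¬-not (a≰b ∘ ≤ᵇ⇒≤ _ _ ∘ Equivalence.from T-≡)

refl₁-≤ : ∀ k a → a ≤ k → refl₁ k a ≡ k ∸ a
refl₁-≤ k a a≤k rewrite ≤ᵇ-≡true a≤k = refl

refl₂-≤ : ∀ k a → a ≤ k ∸ 2 → refl₂ k a ≡ k ∸ 2 ∸ a
refl₂-≤ k a a≤k-2 rewrite ≤ᵇ-≡true a≤k-2 = refl

refl₂-> : ∀ k a → ¬ a ≤ k ∸ 2 → refl₂ k a ≡ 3 * k ∸ 2 ∸ a
refl₂-> k a a≰k-2 rewrite ≤ᵇ-≡false a≰k-2 = refl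

fromAngle-< : ∀ {k a} (a<k : a < k) → fromAngle k a ≡ posα (fromℕ< a<k)
fromAngle-< {k} {a} a<k with a <? k
... | yes _   = refl
... | no  a≮k = contradiction a<k a≮k

fromAngle-≡ : ∀ k → fromAngle k k ≡ negα zero
fromAngle-≡ k with k <? k
... | yes k<k = contradiction k<k (<-irrefl refl)
... | no _ with k ≟ k
...   | yes _   = refl
...   | no k≢k  = contradiction refl k≢k

fromAngle-> : ∀ {k a} → k < a → fromAngle k a ≡ negα (suc zero)
fromAngle-> {k} {a} k<a with a <? k
... | yes a<k = contradiction k<a (<-asym a<k)
... | no _ with a ≟ k
...   | yes a≡k = contradiction (sym a≡k) (<⇒≢ k<a)
...   | no _    = refl

module Coordinates (K M : ℕ) where

  k m : ℕ
  k = 2 + K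
  m = suc M

  R : Col k m → Col k m
  R = Rm k m

  -- The bounds are irrelevant, so posc′ depends only on the two indices.
  posc′ : (j : ℕ) → .(j < k) → (i : ℕ) → .(i < m) → Col k m
  posc′ j p i q = posc (fromℕ< p) (fromℕ< q)

  posc′-cong : ∀ {j j′ i i′} .{p p′ q q′} → j ≡ j′ → i ≡ i′ → posc′ j p i q ≡ posc′ j′ p′ i′ q′
  posc′-cong refl refl = refl

  posc≡posc′ : ∀ j i → posc j i ≡ posc′ (toℕ j) (toℕ<n j) (toℕ i) (toℕ<n i)
  posc≡posc′ j i = sym (cong₂ posc (fromℕ<-toℕ j (toℕ<n j)) (fromℕ<-toℕ i (toℕ<n i)))

  0<m : 0 < m
  0<m = z<s

  M<m : M < m
  M<m = ≤-refl

  K<k : K < k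
  K<k = m<n⇒m<1+n ≤-refl

  Rot-posα-2+ : ∀ n (p : 2 + n < k) .(q : n < k) → Rot k (posα (fromℕ< p)) ≡ posα (fromℕ< q)
  Rot-posα-2+ n p q = begin
    τ₋ k (fromAngle k (refl₁ k (toℕ (fromℕ< p))))  ≡⟨ cong (λ j → τ₋ k (fromAngle k (refl₁ k j))) (toℕ-fromℕ< p) ⟩
    τ₋ k (fromAngle k (refl₁ k (2 + n)))           ≡⟨ cong (τ₋ k ∘ fromAngle k) (refl₁-≤ k (2 + n) (<⇒≤ p)) ⟩
    τ₋ k (fromAngle k (K ∸ n))                     ≡⟨ cong (τ₋ k) (fromAngle-< K∸n<k) ⟩
    fromAngle k (refl₂ k (toℕ (fromℕ< K∸n<k)))     ≡⟨ cong (fromAngle k ∘ refl₂ k) (toℕ-fromℕ< K∸n<k) ⟩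
    fromAngle k (refl₂ k (K ∸ n))                  ≡⟨ cong (fromAngle k) (refl₂-≤ k (K ∸ n) (m∸n≤m K n)) ⟩
    fromAngle k (K ∸ (K ∸ n))                      ≡⟨ cong (fromAngle k) (m∸[m∸n]≡n (≤-pred (≤-pred (<⇒≤ p)))) ⟩
    fromAngle k n                                  ≡⟨ fromAngle-< (<-trans (m<n+m n z<s) p) ⟩
    posα (fromℕ< q)                                ∎
    where
    open ≡-Reasoning
    K∸n<k : K ∸ n < k
    K∸n<k = s≤s (m≤n⇒m≤1+n (m∸n≤m K n))

  Rot-posα-1 : (p : 1 < k) → Rot k (posα (fromℕ< p)) ≡ negα (suc zero)
  Rot-posα-1 p = begin
    τ₋ k (fromAngle k (refl₁ k (toℕ (fromℕ< p))))  ≡⟨ cong (λ j → τ₋ k (fromAngle k (refl₁ k j))) (toℕ-fromℕ< p) ⟩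
    τ₋ k (fromAngle k (refl₁ k 1))                 ≡⟨ cong (τ₋ k ∘ fromAngle k) (refl₁-≤ k 1 (<⇒≤ p)) ⟩
    τ₋ k (fromAngle k (suc K))                     ≡⟨ cong (τ₋ k) (fromAngle-< ≤-refl) ⟩
    fromAngle k (refl₂ k (toℕ (fromℕ< 1+K<k)))     ≡⟨ cong (fromAngle k ∘ refl₂ k) (toℕ-fromℕ< 1+K<k) ⟩
    fromAngle k (refl₂ k (suc K))                  ≡⟨ cong (fromAngle k) (refl₂-> k (suc K) (1+n≰n {K})) ⟩
    fromAngle k (3 * k ∸ 2 ∸ suc K)                ≡⟨ cong (λ a → fromAngle k (a ∸ suc K)) (3k-2≡ K) ⟩
    fromAngle k (suc K + (3 + (K + K)) ∸ suc K)    ≡⟨ cong (fromAngle k) (m+n∸m≡n (suc K) (3 + (K + K))) ⟩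
    fromAngle k (3 + (K + K))                      ≡⟨ fromAngle-> (s<s (s<s (s<s (m≤n+m K K)))) ⟩
    negα (suc zero)                                ∎
    where
    open ≡-Reasoning
    1+K<k : suc K < k
    1+K<k = ≤-refl
    3k-2≡ : ∀ K → K + (2 + K + (2 + K + 0)) ≡ suc K + (3 + (K + K))
    3k-2≡ = solve-∀

  Rot-posα-0 : Rot k (posα zero) ≡ negα zero
  Rot-posα-0 = cong (τ₋ k) (fromAngle-≡ k)

  Rot-negα₁ : Rot k (negα zero) ≡ posα (fromℕ< K<k)
  Rot-negα₁ = begin
    τ₋ k (fromAngle k (refl₁ k k))  ≡⟨ cong (τ₋ k ∘ fromAngle k) (refl₁-≤ k k ≤-refl) ⟩
    τ₋ k (fromAngle k (k ∸ k))      ≡⟨ cong (τ₋ k ∘ fromAngle k) (n∸n≡0 k) ⟩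
    τ₋ k (fromAngle k 0)            ≡⟨ cong (τ₋ k) (fromAngle-< z<s) ⟩
    fromAngle k K                   ≡⟨ fromAngle-< K<k ⟩
    posα (fromℕ< K<k)               ∎
    where open ≡-Reasoning

  Rot-negα₂ : Rot k (negα (suc zero)) ≡ posα (fromℕ< {suc K} ≤-refl)
  Rot-negα₂ = begin
    fromAngle k (refl₂ k (2 * k ∸ 1))            ≡⟨ cong (fromAngle k) (refl₂-> k (2 * k ∸ 1) 2k-1≰K) ⟩
    fromAngle k (3 * k ∸ 2 ∸ (2 * k ∸ 1))        ≡⟨ cong (λ a → fromAngle k (a ∸ (2 * k ∸ 1))) (3k-2≡ K) ⟩
    fromAngle k (2 * k ∸ 1 + suc K ∸ (2 * k ∸ 1)) ≡⟨ cong (fromAngle k) (m+n∸m≡n (2 * k ∸ 1) (suc K)) ⟩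
    fromAngle k (suc K)                          ≡⟨ fromAngle-< ≤-refl ⟩
    posα (fromℕ< ≤-refl)                         ∎
    where
    open ≡-Reasoning
    2k-1≰K : ¬ 2 * k ∸ 1 ≤ K
    2k-1≰K 2k-1≤K = 1+n≰n (≤-trans (s≤s (m≤m+n K _)) 2k-1≤K)
    3k-2≡ : ∀ K → K + (2 + K + (2 + K + 0)) ≡ suc K + (2 + K + 0) + suc K
    3k-2≡ = solve-∀

  Rm-nextColour : ∀ j .(p : j < k) i .(q : i < m) (q′ : suc i < m) → R (posc′ j p i q) ≡ posc′ j p (suc i) q′
  Rm-nextColour j p i q q′ with suc (toℕ (fromℕ< q)) <? m
  ... | yes r  = posc′-cong {p = p} {p′ = p} {q = r} {q′ = q′} refl (cong suc (toℕ-fromℕ< q))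
  ... | no ¬q′ = contradiction (subst (λ i → suc i < m) (sym (toℕ-fromℕ< q)) q′) ¬q′

  Rm-lastColour : ∀ j .(p : j < k) .(q : M < m) → R (posc′ j p M q) ≡ colour1 k m (Rot k (posα (fromℕ< p)))
  Rm-lastColour j p q with suc (toℕ (fromℕ< q)) <? m
  ... | yes M+1<m = contradiction (subst (λ i → suc i < m) (toℕ-fromℕ< q) M+1<m) (<-irrefl refl)
  ... | no _      = refl

  Rm-lastColour-2+ : ∀ n (p : 2 + n < k) .(q : n < k) → R (posc′ (2 + n) p M M<m) ≡ posc′ n q 0 0<m
  Rm-lastColour-2+ n p q = trans (Rm-lastColour (2 + n) p M<m) (cong (colour1 k m) (Rot-posα-2+ n p q))

  Rm-exit : ∀ ε .(p : toℕ ε < k) → R (posc′ (toℕ ε) p M M<m) ≡ negc ε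
  Rm-exit zero       p = trans (Rm-lastColour 0 p M<m) (cong (colour1 k m) Rot-posα-0)
  Rm-exit (suc zero) p = trans (Rm-lastColour 1 p M<m) (cong (colour1 k m) (Rot-posα-1 (s≤s (s≤s z≤n))))

  Rm-entry : ∀ ε .(p : K + toℕ ε < k) → R (negc ε) ≡ posc′ (K + toℕ ε) p 0 0<m
  Rm-entry zero       p = trans (cong (colour1 k m) Rot-negα₁)
    (posc′-cong {p = K<k} {p′ = p} {q = 0<m} {q′ = 0<m} (sym (+-identityʳ K)) refl)
  Rm-entry (suc zero) p = trans (cong (colour1 k m) Rot-negα₂)
    (posc′-cong {p = ≤-refl} {p′ = p} {q = 0<m} {q′ = 0<m} (+-comm 1 K) refl)

  iter-Rm-colours : ∀ j .(p : j < k) i (q : i < m) → iter i R (posc′ j p 0 0<m) ≡ posc′ j p i q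
  iter-Rm-colours j p zero    q = refl
  iter-Rm-colours j p (suc i) q = trans (cong R (iter-Rm-colours j p i (<-trans (n<1+n i) q))) (Rm-nextColour j p i _ q)

  iter-Rm-block : ∀ n (p : 2 + n < k) .(q : n < k) → iter m R (posc′ (2 + n) p 0 0<m) ≡ posc′ n q 0 0<m
  iter-Rm-block n p q = trans (cong R (iter-Rm-colours (2 + n) p M M<m)) (Rm-lastColour-2+ n p q)

  iter-Rm-blocks : ∀ t n (p : 2 * t + n < k) .(q : n < k) → iter (t * m) R (posc′ (2 * t + n) p 0 0<m) ≡ posc′ n q 0 0<m
  iter-Rm-blocks zero    n p q = refl
  iter-Rm-blocks (suc t) n p q = begin
    iter (m + t * m) R (posc′ (2 * suc t + n) p 0 0<m)            ≡⟨ iter-+ R m (t * m) _ ⟩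
    iter m R (iter (t * m) R (posc′ (2 * suc t + n) p 0 0<m))     ≡⟨ cong (iter m R ∘ iter (t * m) R) p≡p′ ⟩
    iter m R (iter (t * m) R (posc′ (2 * t + (2 + n)) p′ 0 0<m))  ≡⟨ cong (iter m R) (iter-Rm-blocks t (2 + n) p′ 2+n<k) ⟩
    iter m R (posc′ (2 + n) 2+n<k 0 0<m)                          ≡⟨ iter-Rm-block n 2+n<k q ⟩
    posc′ n q 0 0<m                                               ∎
    where
    open ≡-Reasoning
    2[1+t]+n≡ : ∀ t n → 2 * suc t + n ≡ 2 * t + (2 + n)
    2[1+t]+n≡ = solve-∀
    p′ : 2 * t + (2 + n) < k
    p′ = subst (_< k) (2[1+t]+n≡ t n) p
    2+n<k : 2 + n < k
    2+n<k = ≤-<-trans (m≤n+m (2 + n) (2 * t)) p′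
    p≡p′ : posc′ (2 * suc t + n) p 0 0<m ≡ posc′ (2 * t + (2 + n)) p′ 0 0<m
    p≡p′ = posc′-cong {p = p} {p′ = p′} {q = 0<m} {q′ = 0<m} (2[1+t]+n≡ t n) refl

  iter-Rm-descend : ∀ t n (p : 2 * t + n < k) .(p′ : n < k) i (q : i < m) →
                    iter (i + t * m) R (posc′ (2 * t + n) p 0 0<m) ≡ posc′ n p′ i q
  iter-Rm-descend t n p p′ i q = begin
    iter (i + t * m) R (posc′ (2 * t + n) p 0 0<m)  ≡⟨ iter-+ R i (t * m) _ ⟩
    iter i R (iter (t * m) R (posc′ (2 * t + n) p 0 0<m)) ≡⟨ cong (iter i R) (iter-Rm-blocks t n p p′) ⟩
    iter i R (posc′ n p′ 0 0<m)                     ≡⟨ iter-Rm-colours n p′ i q ⟩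
    posc′ n p′ i q                                  ∎
    where open ≡-Reasoning

  K+ε<k : ∀ ε → K + toℕ ε < k
  K+ε<k ε = subst (_< k) (+-comm (toℕ ε) K) (+-monoˡ-< K (toℕ<n ε))

  iter-Rm-negα-entry : ∀ n ε → iter (n + 1) R (negc ε) ≡ iter n R (posc′ (K + toℕ ε) (K+ε<k ε) 0 0<m)
  iter-Rm-negα-entry n ε = trans (iter-+ R n 1 (negc ε)) (cong (iter n R) (Rm-entry ε (K+ε<k ε)))

  iter-Rm-from-negα : ∀ ε t j → 2 * t + j ≡ K + toℕ ε → .(p : j < k) → ∀ i (q : i < m) →
                      iter (i + t * m + 1) R (negc ε) ≡ posc′ j p i q
  iter-Rm-from-negα ε t j e p i q = begin
    iter (i + t * m + 1) R (negc ε)                  ≡⟨ iter-Rm-negα-entry (i + t * m) ε ⟩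
    iter (i + t * m) R (posc′ (K + toℕ ε) _ 0 0<m)   ≡⟨ cong (iter (i + t * m) R) entry≡ ⟩
    iter (i + t * m) R (posc′ (2 * t + j) p′ 0 0<m)  ≡⟨ iter-Rm-descend t j p′ p i q ⟩
    posc′ j p i q                                    ∎
    where
    open ≡-Reasoning
    p′ : 2 * t + j < k
    p′ = subst (_< k) (sym e) (K+ε<k ε)
    entry≡ : posc′ (K + toℕ ε) (K+ε<k ε) 0 0<m ≡ posc′ (2 * t + j) p′ 0 0<m
    entry≡ = posc′-cong {p = K+ε<k ε} {p′ = p′} {q = 0<m} {q′ = 0<m} (sym e) refl

  iter-Rm-negα : ∀ t ε ε′ → 2 * t + toℕ ε′ ≡ K + toℕ ε → iter (suc t * m + 1) R (negc ε) ≡ negc ε′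
  iter-Rm-negα t ε ε′ e = begin
    iter (suc t * m + 1) R (negc ε)                           ≡⟨ iter-Rm-negα-entry (suc t * m) ε ⟩
    iter (suc t * m) R (posc′ (K + toℕ ε) _ 0 0<m)            ≡⟨ cong (iter (suc t * m) R) entry≡ ⟩
    R (iter (M + t * m) R (posc′ (2 * t + toℕ ε′) p′ 0 0<m))  ≡⟨ cong R (iter-Rm-descend t (toℕ ε′) p′ ε′<k M M<m) ⟩
    R (posc′ (toℕ ε′) ε′<k M M<m)                             ≡⟨ Rm-exit ε′ ε′<k ⟩
    negc ε′                                                   ∎
    where
    open ≡-Reasoning
    p′ : 2 * t + toℕ ε′ < k
    p′ = subst (_< k) (sym e) (K+ε<k ε)
    entry≡ : posc′ (K + toℕ ε) (K+ε<k ε) 0 0<m ≡ posc′ (2 * t + toℕ ε′) p′ 0 0<m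
    entry≡ = posc′-cong {p = K+ε<k ε} {p′ = p′} {q = 0<m} {q′ = 0<m} (sym e) refl
    ε′<k : toℕ ε′ < k
    ε′<k = ≤-<-trans (m≤n+m (toℕ ε′) (2 * t)) p′

  depth+j≡1+K : ∀ (j : Fin k) → (suc K ∸ toℕ j) + toℕ j ≡ suc K
  depth+j≡1+K j = m∸n+n≡m (≤-pred (toℕ<n j))

  negα-orbits-cover : ∀ a → ∃₂ λ ε e → iter e R (negc ε) ≡ a
  negα-orbits-cover (negc ε)   = ε , 0 , refl
  negα-orbits-cover (posc j i) with even-or-odd (suc K ∸ toℕ j)
  ... | inj₁ (t , depth≡t+t) = suc zero , toℕ i + t * m + 1 ,
        trans (iter-Rm-from-negα (suc zero) t (toℕ j) 2t+j≡ (toℕ<n j) (toℕ i) (toℕ<n i)) (sym (posc≡posc′ j i))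
    where
    2t+j≡ : 2 * t + toℕ j ≡ K + 1
    2t+j≡ = begin
      2 * t + toℕ j               ≡⟨ cong (_+ toℕ j) (trans (2*n≡n+n t) (sym depth≡t+t)) ⟩
      (suc K ∸ toℕ j) + toℕ j     ≡⟨ depth+j≡1+K j ⟩
      suc K                       ≡⟨ +-comm 1 K ⟩
      K + 1                       ∎
      where open ≡-Reasoning
  ... | inj₂ (t , depth≡1+t+t) = zero , toℕ i + t * m + 1 ,
        trans (iter-Rm-from-negα zero t (toℕ j) 2t+j≡ (toℕ<n j) (toℕ i) (toℕ<n i)) (sym (posc≡posc′ j i))
    where
    2t+j≡ : 2 * t + toℕ j ≡ K + 0
    2t+j≡ = suc-injective (begin
      suc (2 * t + toℕ j)         ≡⟨ cong (λ n → suc (n + toℕ j)) (2*n≡n+n t) ⟩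
      suc (t + t) + toℕ j         ≡⟨ cong (_+ toℕ j) depth≡1+t+t ⟨
      (suc K ∸ toℕ j) + toℕ j     ≡⟨ depth+j≡1+K j ⟩
      suc K                       ≡⟨ cong suc (+-identityʳ K) ⟨
      suc (K + 0)                 ∎)
      where open ≡-Reasoning

-- Even k

module EvenRank (r₁ M : ℕ) where

  r : ℕ
  r = 2 + r₁

  open Coordinates (r₁ + r) M public

  h : ℕ
  h = r * m + 1

  Rm-half-turn-negα : ∀ ε → iter h R (negc ε) ≡ negc ε
  Rm-half-turn-negα ε = iter-Rm-negα (suc r₁) ε ε (cong (_+ toℕ ε) (2[1+r₁]≡ r₁))
    where
    2[1+r₁]≡ : ∀ r₁ → 2 * suc r₁ ≡ r₁ + (2 + r₁)
    2[1+r₁]≡ = solve-∀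

  Rm-half-turn : ∀ a → iter h R a ≡ a
  Rm-half-turn a with negα-orbits-cover a
  ... | ε , e , refl = trans (iter-comm R h e (negc ε)) (cong (iter e R) (Rm-half-turn-negα ε))

half-turn-even : ∀ r m h .{{_ : NonZero m}} → 3 ≤ r + r → m * (r + r) + 2 ≡ 2 * h →
                 ∀ a → iter h (Rm (r + r) m) a ≡ a
half-turn-even (suc zero) _ _ (s≤s (s≤s ())) _
half-turn-even (suc (suc r₁)) (suc M) h _ mk+2≡2h a =
  subst (λ n → iter n R a ≡ a) (sym h≡) (Rm-half-turn a)
  where
  open EvenRank r₁ M using (R; Rm-half-turn)
  mk+2≡ : ∀ r₁ M → suc M * (2 + r₁ + (2 + r₁)) + 2 ≡ 2 * ((2 + r₁) * suc M + 1)
  mk+2≡ = solve-∀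
  h≡ : h ≡ EvenRank.h r₁ M
  h≡ = *-cancelˡ-≡ h _ 2 (trans (sym mk+2≡2h) (mk+2≡ r₁ M))

-- Odd k

module OddRank (r₀ m₀ : ℕ) where

  r m′ : ℕ
  r  = suc r₀
  m′ = suc m₀

  K M : ℕ
  K = r₀ + r
  M = m₀ + m′

  open Coordinates K M public

  w h N : ℕ
  w = 1 + r * m
  h = m′ + w
  N = h + h

  ρ : Col k m → Col k m
  ρ = iter h R

  U : ℕ → Col k m
  U p = iter p R (negc (suc zero))

  U-+ : ∀ a b → U (a + b) ≡ iter a R (U b)
  U-+ a b = iter-+ R a b (negc (suc zero))

  U-negα₁ : U (suc r * m + 1) ≡ negc zero
  U-negα₁ = iter-Rm-negα r (suc zero) zero (2r+0≡ r₀)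
    where
    2r+0≡ : ∀ r₀ → 2 * suc r₀ + 0 ≡ r₀ + suc r₀ + 1
    2r+0≡ = solve-∀

  U-N : U N ≡ negc (suc zero)
  U-N = begin
    U N                                    ≡⟨ cong U (N≡ r m′) ⟩
    U ((r * m + 1) + (suc r * m + 1))      ≡⟨ U-+ (r * m + 1) (suc r * m + 1) ⟩
    iter (r * m + 1) R (U (suc r * m + 1)) ≡⟨ cong (iter (r * m + 1) R) U-negα₁ ⟩
    iter (r * m + 1) R (negc zero)         ≡⟨ iter-Rm-negα r₀ zero (suc zero) (2r₀+1≡ r₀) ⟩
    negc (suc zero)                        ∎
    where
    open ≡-Reasoning
    N≡ : ∀ r m′ → m′ + (1 + r * (m′ + m′)) + (m′ + (1 + r * (m′ + m′))) ≡ (r * (m′ + m′) + 1) + (suc r * (m′ + m′) + 1)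
    N≡ = solve-∀
    2r₀+1≡ : ∀ r₀ → 2 * r₀ + 1 ≡ r₀ + suc r₀ + 0
    2r₀+1≡ = solve-∀

  U-+N : ∀ p → U (p + N) ≡ U p
  U-+N p = trans (U-+ p N) (cong (iter p R) U-N)

  U-+*N : ∀ p t → U (p + t * N) ≡ U p
  U-+*N p zero    = cong U (+-identityʳ p)
  U-+*N p (suc t) = trans (cong U (p+[N+x]≡ p N (t * N))) (trans (U-+N (p + t * N)) (U-+*N p t))
    where
    p+[N+x]≡ : ∀ p N x → p + (N + x) ≡ p + x + N
    p+[N+x]≡ = solve-∀

  U-%N : ∀ p → U (p % N) ≡ U p
  U-%N p = sym (trans (cong U (m≡m%n+[m/n]*n p N)) (U-+*N (p % N) (p / N)))

  negα-∈U : ∀ ε → ∃ λ p → U p ≡ negc ε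
  negα-∈U zero       = suc r * m + 1 , U-negα₁
  negα-∈U (suc zero) = 0 , refl

  U-surjective : ∀ a → ∃ λ p → p < N × U p ≡ a
  U-surjective a with negα-orbits-cover a
  ... | ε , e , refl with negα-∈U ε
  ...   | p , Up≡negα = (e + p) % N , m%n<n (e + p) N ,
          trans (U-%N (e + p)) (trans (U-+ e p) (cong (iter e R) Up≡negα))

  -- U visits -α₂, the colours of β_{2r}, β_{2r-2}, …, β₀, then -α₁, the colours of β_{2r-1}, …, β₁,
  -- and is back at -α₂ after N steps; position a is the time of the visit to a, and offset d that
  -- of β_{2r-d}^1.
  offset : ℕ → ℕ
  offset zero                = 1
  offset (suc zero)          = 1 + (suc r * m + 1)
  offset (suc (suc depth))   = m + offset depth

  position : Col k m → ℕ
  position (negc zero)       = suc r * m + 1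
  position (negc (suc zero)) = 0
  position (posc j i)        = toℕ i + offset (r + r ∸ toℕ j)

  offset-even : ∀ t → offset (t + t) ≡ t * m + 1
  offset-even zero    = refl
  offset-even (suc t) = begin
    offset (suc (t + suc t))  ≡⟨ cong (λ d → offset (suc d)) (+-suc t t) ⟩
    m + offset (t + t)        ≡⟨ cong (m +_) (offset-even t) ⟩
    m + (t * m + 1)           ≡⟨ +-assoc m (t * m) 1 ⟨
    suc t * m + 1             ∎
    where open ≡-Reasoning

  offset-odd : ∀ t → offset (suc (t + t)) ≡ t * m + offset 1
  offset-odd zero    = refl
  offset-odd (suc t) = begin
    offset (suc (suc (t + suc t)))  ≡⟨ cong (λ d → offset (suc (suc d))) (+-suc t t) ⟩
    m + offset (suc (t + t))        ≡⟨ cong (m +_) (offset-odd t) ⟩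
    m + (t * m + offset 1)          ≡⟨ +-assoc m (t * m) (offset 1) ⟨
    suc t * m + offset 1            ∎
    where open ≡-Reasoning

  position-posc′ : ∀ j .(p : j < k) i .(q : i < m) → position (posc′ j p i q) ≡ i + offset (r + r ∸ j)
  position-posc′ j p i q = cong₂ (λ i j → i + offset (r + r ∸ j)) (toℕ-fromℕ< q) (toℕ-fromℕ< p)

  position-Rm-lastColour : ∀ j (p : j < k) → suc (position (posc′ j p M M<m)) < N →
                           position (R (posc′ j p M M<m)) ≡ suc (position (posc′ j p M M<m))
  position-Rm-lastColour zero p _ = begin
    position (R (posc′ 0 p M M<m))       ≡⟨ cong position (Rm-exit zero p) ⟩
    suc r * m + 1                        ≡⟨ +-assoc (suc M) (r * m) 1 ⟩
    suc (M + (r * m + 1))                ≡⟨ cong (λ x → suc (M + x)) (offset-even r) ⟨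
    suc (M + offset (r + r))             ≡⟨ cong suc (position-posc′ 0 p M M<m) ⟨
    suc (position (posc′ 0 p M M<m))     ∎
    where open ≡-Reasoning
  position-Rm-lastColour (suc zero) p last+1<N = ⊥-elim (<-irrefl last+1≡N last+1<N)
    where
    last+1≡N : suc (position (posc′ 1 p M M<m)) ≡ N
    last+1≡N = begin
      suc (position (posc′ 1 p M M<m))    ≡⟨ cong suc (position-posc′ 1 p M M<m) ⟩
      suc (M + offset (r₀ + suc r₀))      ≡⟨ cong (λ d → suc (M + offset d)) (+-suc r₀ r₀) ⟩
      suc (M + offset (suc (r₀ + r₀)))    ≡⟨ cong (λ x → suc (M + x)) (offset-odd r₀) ⟩
      suc (M + (r₀ * m + offset 1))       ≡⟨ ≡N r₀ m₀ ⟩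
      N                                   ∎
      where
      open ≡-Reasoning
      ≡N : ∀ r₀ m₀ → suc (m₀ + suc m₀ + (r₀ * suc (m₀ + suc m₀) + (1 + (suc (suc r₀) * suc (m₀ + suc m₀) + 1))))
                     ≡ suc m₀ + (1 + suc r₀ * suc (m₀ + suc m₀)) + (suc m₀ + (1 + suc r₀ * suc (m₀ + suc m₀)))
      ≡N = solve-∀
  position-Rm-lastColour (suc (suc n)) p _ = begin
    position (R (posc′ (2 + n) p M M<m))   ≡⟨ cong position (Rm-lastColour-2+ n p n<k) ⟩
    position (posc′ n n<k 0 0<m)           ≡⟨ position-posc′ n n<k 0 0<m ⟩
    offset (r + r ∸ n)                     ≡⟨ cong offset (+-∸-assoc 2 (≤-pred p)) ⟩
    m + offset (r + r ∸ (2 + n))           ≡⟨ cong suc (position-posc′ (2 + n) p M M<m) ⟨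
    suc (position (posc′ (2 + n) p M M<m)) ∎
    where
    open ≡-Reasoning
    n<k : n < k
    n<k = <-trans (m<n+m n z<s) p

  position-Rm-posc′ : ∀ j (p : j < k) i (q : i < m) → suc (position (posc′ j p i q)) < N →
                      position (R (posc′ j p i q)) ≡ suc (position (posc′ j p i q))
  position-Rm-posc′ j p i q _ with suc i <? m
  position-Rm-posc′ j p i q _ | yes q′ = begin
    position (R (posc′ j p i q))         ≡⟨ cong position (Rm-nextColour j p i q q′) ⟩
    position (posc′ j p (suc i) q′)      ≡⟨ position-posc′ j p (suc i) q′ ⟩
    suc (i + offset (r + r ∸ j))         ≡⟨ cong suc (position-posc′ j p i q) ⟨
    suc (position (posc′ j p i q))       ∎
    where open ≡-Reasoning
  position-Rm-posc′ j p i q last+1<N | no i+1≮m with ≤-antisym (≤-pred q) (≤-pred (≮⇒≥ i+1≮m))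
  ... | refl = position-Rm-lastColour j p last+1<N

  position-Rm : ∀ a → suc (position a) < N → position (R a) ≡ suc (position a)
  position-Rm (negc zero) _ = begin
    position (R (negc zero))                ≡⟨ cong position (Rm-entry zero (K+ε<k zero)) ⟩
    position (posc′ (K + 0) _ 0 0<m)        ≡⟨ position-posc′ (K + 0) (K+ε<k zero) 0 0<m ⟩
    offset (suc K ∸ (K + 0))                ≡⟨ cong (λ d → offset (suc K ∸ d)) (+-identityʳ K) ⟩
    offset (suc K ∸ K)                      ≡⟨ cong offset (m+n∸n≡m 1 K) ⟩
    suc (position (negc zero))              ∎
    where open ≡-Reasoning
  position-Rm (negc (suc zero)) _ = begin
    position (R (negc (suc zero)))          ≡⟨ cong position (Rm-entry (suc zero) (K+ε<k (suc zero))) ⟩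
    position (posc′ (K + 1) _ 0 0<m)        ≡⟨ position-posc′ (K + 1) (K+ε<k (suc zero)) 0 0<m ⟩
    offset (suc K ∸ (K + 1))                ≡⟨ cong (λ d → offset (suc K ∸ d)) (+-comm K 1) ⟩
    offset (K ∸ K)                          ≡⟨ cong offset (n∸n≡0 K) ⟩
    suc (position (negc (suc zero)))        ∎
    where open ≡-Reasoning
  position-Rm (posc j i) =
    subst (λ a → suc (position a) < N → position (R a) ≡ suc (position a)) (sym (posc≡posc′ j i))
          (position-Rm-posc′ (toℕ j) (toℕ<n j) (toℕ i) (toℕ<n i))

  position-U : ∀ p → p < N → position (U p) ≡ p
  position-U zero    _     = refl
  position-U (suc p) p+1<N = begin
    position (R (U p))  ≡⟨ position-Rm (U p) (subst (λ q → suc q < N) (sym IH) p+1<N) ⟩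
    suc (position (U p)) ≡⟨ cong suc IH ⟩
    suc p               ∎
    where
    open ≡-Reasoning
    IH : position (U p) ≡ p
    IH = position-U p (<-trans (n<1+n p) p+1<N)

  U-injective : ∀ p q → p < N → q < N → U p ≡ U q → p ≡ q
  U-injective p q p<N q<N Up≡Uq =
    trans (sym (position-U p p<N)) (trans (cong position Up≡Uq) (position-U q q<N))

  U-position : ∀ a → U (position a) ≡ a
  U-position a with U-surjective a
  ... | p , p<N , refl = cong U (position-U p p<N)

  ρ-U : ∀ p → ρ (U p) ≡ U (h + p)
  ρ-U p = sym (U-+ h p)

  ρ-involutive : ∀ a → ρ (ρ a) ≡ a
  ρ-involutive a with U-surjective a
  ... | p , _ , refl = begin
    ρ (ρ (U p))       ≡⟨ cong ρ (ρ-U p) ⟩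
    ρ (U (h + p))     ≡⟨ ρ-U (h + p) ⟩
    U (h + (h + p))   ≡⟨ cong U (h+[h+p]≡ h p) ⟩
    U (p + N)         ≡⟨ U-+N p ⟩
    U p               ∎
    where
    open ≡-Reasoning
    h+[h+p]≡ : ∀ h p → h + (h + p) ≡ p + (h + h)
    h+[h+p]≡ = solve-∀

  α₂-free : Col k m → Set
  α₂-free = CoeffZero k m (suc zero)

  -- w is the position of β₀^1, the start of the window of α₂-free roots.
  α₂-free-position : ∀ a → α₂-free a → ∃ λ e → e ≤ m × position a ≡ e + w
  α₂-free-position (negc (suc zero)) ()
  α₂-free-position (negc zero) _ = m , ≤-refl , ≡m+w m (r * m)
    where
    ≡m+w : ∀ m x → m + x + 1 ≡ m + (1 + x)
    ≡m+w = solve-∀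
  α₂-free-position (posc j i) j≡0 = toℕ i , <⇒≤ (toℕ<n i) , (begin
    toℕ i + offset (r + r ∸ toℕ j)  ≡⟨ cong (λ j → toℕ i + offset (r + r ∸ j)) j≡0 ⟩
    toℕ i + offset (r + r)          ≡⟨ cong (toℕ i +_) (offset-even r) ⟩
    toℕ i + (r * m + 1)             ≡⟨ cong (toℕ i +_) (+-comm (r * m) 1) ⟩
    toℕ i + w                       ∎)
    where open ≡-Reasoning

  m<w : m < w
  m<w = s≤s (m≤m+n m (r₀ * m))

  m<h : m < h
  m<h = <-≤-trans m<w (m≤n+m w m′)

  m′<w : m′ < w
  m′<w = ≤-<-trans (m≤m+n m′ m′) m<w

  window<N : ∀ {e} → e ≤ m → e + w < N
  window<N e≤m = <-≤-trans (+-monoˡ-< w (≤-<-trans e≤m m<h)) (+-monoʳ-≤ h (m≤n+m w m′))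

  -- m < h, so translating the window by the half period h moves it off itself.
  ρ-moves-window : ∀ e e′ → e ≤ m → e′ ≤ m → U (h + (e + w)) ≢ U (e′ + w)
  ρ-moves-window e e′ e≤m e′≤m U≡U with m′ ≤? e
  ... | no e≱m′ = <-irrefl (sym (U-injective s (e′ + w) s<N (window<N e′≤m) U≡U)) (begin-strict
        e′ + w        ≤⟨ +-monoˡ-≤ w e′≤m ⟩
        m + w         <⟨ +-monoˡ-< w m<h ⟩
        h + w         ≤⟨ +-monoʳ-≤ h (m≤n+m w e) ⟩
        s             ∎)
    where
    open ≤-Reasoning
    s : ℕ
    s = h + (e + w)
    s<N : s < N
    s<N = +-monoʳ-< h (+-monoˡ-< w (≰⇒> e≱m′))
  ... | yes m′≤e = <-irrefl (U-injective f (e′ + w) f<N (window<N e′≤m) Uf≡U) (<-≤-trans f<w (m≤n+m w e′))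
    where
    f : ℕ
    f = e ∸ m′
    f≤m′ : f ≤ m′
    f≤m′ = +-cancelˡ-≤ m′ f m′ (subst (_≤ m) (sym (m+[n∸m]≡n m′≤e)) e≤m)
    f<w : f < w
    f<w = ≤-<-trans f≤m′ m′<w
    f<N : f < N
    f<N = <-≤-trans f<w (≤-trans (m≤n+m w m′) (m≤m+n h h))
    h+[e+w]≡f+N : h + (e + w) ≡ f + N
    h+[e+w]≡f+N = begin
      h + (e + w)               ≡⟨ cong (λ e → h + (e + w)) (m+[n∸m]≡n m′≤e) ⟨
      m′ + w + ((m′ + f) + w)   ≡⟨ rearrange m′ f w ⟩
      f + N                     ∎
      where
      open ≡-Reasoning
      rearrange : ∀ m′ f w → m′ + w + ((m′ + f) + w) ≡ f + ((m′ + w) + (m′ + w))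
      rearrange = solve-∀
    Uf≡U : U f ≡ U (e′ + w)
    Uf≡U = trans (sym (U-+N f)) (trans (cong U (sym h+[e+w]≡f+N)) U≡U)

  α₂-free-ρ : ∀ a → α₂-free a → α₂-free (ρ a) → ⊥
  α₂-free-ρ a a-free ρa-free with α₂-free-position a a-free | α₂-free-position (ρ a) ρa-free
  ... | e , e≤m , pos-a | e′ , e′≤m , pos-ρa = ρ-moves-window e e′ e≤m e′≤m (begin
    U (h + (e + w))          ≡⟨ cong (λ p → U (h + p)) pos-a ⟨
    U (h + position a)       ≡⟨ ρ-U (position a) ⟨
    ρ (U (position a))       ≡⟨ cong ρ (U-position a) ⟩
    ρ a                      ≡⟨ U-position (ρ a) ⟨
    U (position (ρ a))       ≡⟨ cong U pos-ρa ⟩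
    U (e′ + w)               ∎)
    where open ≡-Reasoning

  ρ-negα₂-α₂-free : α₂-free (ρ (negc (suc zero)))
  ρ-negα₂-α₂-free = subst α₂-free (sym ρ-negα₂≡) (toℕ-fromℕ< {0} {k} z<s)
    where
    h≡ : ∀ m′ r m → m′ + (1 + r * m) ≡ m′ + r * m + 1
    h≡ = solve-∀
    ρ-negα₂≡ : ρ (negc (suc zero)) ≡ posc′ 0 z<s m′ (m<n+m m′ z<s)
    ρ-negα₂≡ = trans (cong U (h≡ m′ r m)) (iter-Rm-from-negα (suc zero) r 0 (2r+0≡ r₀) z<s m′ (m<n+m m′ z<s))
      where
      2r+0≡ : ∀ r₀ → 2 * suc r₀ + 0 ≡ r₀ + suc r₀ + 1
      2r+0≡ = solve-∀

  module _ {_∥_ : Col k m → Col k m → Set} (C : IsCompatibility k m _∥_) where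
    open IsCompatibility C

    iter-Rm-to-negα₂ : ∀ a → ∃ λ n → iter n R a ≡ negc (suc zero)
    iter-Rm-to-negα₂ a with U-surjective a
    ... | p , p<N , refl = N ∸ p , (begin
      iter (N ∸ p) R (U p)  ≡⟨ U-+ (N ∸ p) p ⟨
      U (N ∸ p + p)         ≡⟨ cong U (m∸n+n≡m (<⇒≤ p<N)) ⟩
      U N                   ≡⟨ U-N ⟩
      negc (suc zero)       ∎)
      where open ≡-Reasoning

    ∥-ρ : ∀ a → a ∥ ρ a
    ∥-ρ a with iter-Rm-to-negα₂ a
    ... | n , aₙ≡negα₂ =
      Equivalence.from (iter-∥⇔ C n a (ρ a)) (subst₂ _∥_ (sym aₙ≡negα₂) ρ-negα₂≡ρaₙ negα₂∥ρ-negα₂)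
      where
      negα₂∥ρ-negα₂ : negc (suc zero) ∥ ρ (negc (suc zero))
      negα₂∥ρ-negα₂ = Equivalence.from (negSimple (suc zero) _) ρ-negα₂-α₂-free
      ρ-negα₂≡ρaₙ : ρ (negc (suc zero)) ≡ iter n R (ρ a)
      ρ-negα₂≡ρaₙ = trans (cong ρ (sym aₙ≡negα₂)) (iter-comm R h n a)

    no-common-neighbour : ∀ c a → c ∥ a → c ∥ ρ a → ⊥
    no-common-neighbour c a c∥a c∥ρa with iter-Rm-to-negα₂ c
    ... | n , cₙ≡negα₂ =
      α₂-free-ρ (iter n R a) (α₂-free-iter c∥a) (subst α₂-free (iter-comm R n h a) (α₂-free-iter c∥ρa))
      where
      α₂-free-iter : ∀ {b} → c ∥ b → α₂-free (iter n R b)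
      α₂-free-iter {b} c∥b = Equivalence.to (negSimple (suc zero) _)
        (subst (_∥ iter n R b) cₙ≡negα₂ (Equivalence.to (iter-∥⇔ C n c b) c∥b))

    open Orbits ρ ρ-involutive

    fixedFacets : HasExactly h (λ F → IsFacet k m _∥_ F × FixedBy ρ F)
    fixedFacets = hasExactly-orbits h U U-injective U-surjective ρ-U _
      (λ a → orbit-isFacet sym∥ ∥-ρ no-common-neighbour a , orbit-fixed a)
      (λ F (F-facet , F-fixed) → fixedFacet-orbit sym∥ ∥-ρ no-common-neighbour F F-facet F-fixed)

fixedFacets-odd : ∀ r m h .{{_ : NonZero m}} → 3 ≤ suc (r + r) → m * suc (r + r) + 2 ≡ 2 * h →
                  (_∥_ : Col (suc (r + r)) m → Col (suc (r + r)) m → Set) →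
                  IsCompatibility (suc (r + r)) m _∥_ →
                  HasExactly h (λ F → IsFacet (suc (r + r)) m _∥_ F × FixedBy (iter h (Rm (suc (r + r)) m)) F)
fixedFacets-odd zero _ _ (s≤s ())
fixedFacets-odd (suc r₀) m h _ mk+2≡2h _∥_ C with even-or-odd m
... | inj₂ (s , refl) =
  contradiction (trans (sym mk+2≡2h) (mk+2≡ s r₀)) (even≢odd h (2 + r₀ + s * suc (suc r₀ + suc r₀)))
  where
  mk+2≡ : ∀ s r₀ → suc (s + s) * suc (suc r₀ + suc r₀) + 2 ≡ suc (2 * (2 + r₀ + s * suc (suc r₀ + suc r₀)))
  mk+2≡ = solve-∀
... | inj₁ (suc m₀ , refl) =
  subst (λ n → HasExactly n (λ F → IsFacet _ _ _∥_ F × FixedBy (iter n (Rm _ _)) F)) (sym h≡) (fixedFacets C)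
  where
  open OddRank r₀ m₀ using (fixedFacets)
  mk+2≡ : ∀ r₀ m₀ → (suc m₀ + suc m₀) * suc (suc r₀ + suc r₀) + 2 ≡ 2 * (suc m₀ + (1 + suc r₀ * (suc m₀ + suc m₀)))
  mk+2≡ = solve-∀
  h≡ : h ≡ OddRank.h r₀ m₀
  h≡ = *-cancelˡ-≡ h _ 2 (trans (sym mk+2≡2h) (mk+2≡ r₀ m₀))

2∤1+n+n : ∀ n → ¬ 2 ∣ suc (n + n)
2∤1+n+n n (divides q 1+n+n≡q*2) = even≢odd q n (begin
  2 * q          ≡⟨ *-comm 2 q ⟩
  q * 2          ≡⟨ 1+n+n≡q*2 ⟨
  suc (n + n)    ≡⟨ cong suc (2*n≡n+n n) ⟨
  suc (2 * n)    ∎)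
  where open ≡-Reasoning

lemma7p5 : (k m h : ℕ) .{{_ : NonZero m}} → 3 ≤ k → m * k + 2 ≡ 2 * h →
    (_∥_ : Col k m → Col k m → Set) → IsCompatibility k m _∥_ →
    (2 ∣ k → ∀ F → IsFacet k m _∥_ F → FixedBy (iter h (Rm k m)) F)
    × (¬ (2 ∣ k) → HasExactly h (λ F → IsFacet k m _∥_ F × FixedBy (iter h (Rm k m)) F))
lemma7p5 k m h 3≤k mk+2≡2h _∥_ C with even-or-odd k
... | inj₁ (r , refl) =
      (λ _ F _ → fixedBy-id (half-turn-even r m h 3≤k mk+2≡2h) F)
    , (λ k-odd → contradiction (divides r (trans (sym (2*n≡n+n r)) (*-comm 2 r))) k-odd)
... | inj₂ (r , refl) =
      (λ k-even → contradiction k-even (2∤1+n+n r))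
    , (λ _ → fixedFacets-odd r m h 3≤k mk+2≡2h _∥_ C)
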